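{- Let $n\ge 2$. Every arithmetical structure on $\mathcal{P}_n$ is equal to $\mathbf{A}_n(\mathbf{b})$ for a unique sequence $\mathbf{b}=(b_1,\dots,b_{n-m})$ (with $2\le m\le n$) satisfying $1\le b_i\le i+m-2$ for all $i$ and $b_i\le b_{i+1}$ for all $i$.
   Context: $\mathcal{P}_N$ is the path graph with vertices $1,\dots,N$ and edges $\{j,j+1\}$. An arithmetical structure on $\mathcal{P}_N$ is a pair $(\mathbf{d},\mathbf{r})$ of positive integer vectors in $\mathbb{Z}^N$ with $\mathbf{r}$ primitive and $(\operatorname{diag}(\mathbf{d})-A)\mathbf{r}=\mathbf{0}$, $A$ the adjacency matrix. The Laplacian arithmetical structure on $\mathcal{P}_N$ is $\mathbf{r}=(1,\dots,1)$, $\mathbf{d}=(1,2,\dots,2,1)$. Subdivision: given an arithmetical structure $(\mathbf{d}',\mathbf{r}')$ on $\mathcal{P}_N$ and $2\le p\le N$, the subdivision at position $p$ is the arithmetical structure $(\mathbf{d},\mathbf{r})$ on $\mathcal{P}_{N+1}$ with $d_j=d'_j$ for $j<p-1$, $d_{p-1}=d'_{p-1}+1$, $d_p=1$, $d_{p+1}=d'_p+1$, $d_j=d'_{j-1}$ for $j>p+1$; and $r_j=r'_j$ for $j<p$, $r_p=r'_{p-1}+r'_p$, $r_j=r'_{j-1}$ for $j>p$. Given $2\le m\le n$ and $\mathbf{b}=(b_1,\dots,b_{n-m})$ with $1\le b_i\le m+i-2$, $\mathbf{A}_n(\mathbf{b})$ is defined by starting with the Laplacian structure on $\mathcal{P}_m$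 and, for $i=1,\dots,n-m$ in turn, subdividing the current structure on $\mathcal{P}_{m+i-1}$ at position $b_i+1$; the result is an arithmetical structure on $\mathcal{P}_n$ ($m$ is $n$ minus the length of $\mathbf{b}$; the empty sequence gives the Laplacian structure on $\mathcal{P}_n$). -}

module Defs where

open import Data.Nat using (ℕ; zero; suc; _+_; _*_; _∸_; _≤_; _<_)
open import Data.Nat.GCD using (gcd)
open import Data.List using (List; []; _∷_; _++_; [_]; replicate; length; foldr; foldl; lookup)
open import Data.List.Relation.Unary.All using (All)
open import Data.List.Relation.Unary.Linked using (Linked)
open import Data.Fin using (Fin; toℕ)
open import Data.Product using (_×_; _,_)
open import Relation.Binary.PropositionalEquality using (_≡_)

-- 1-indexed access with 0 outside the range 1..length:
-- at xs 0 = 0, at xs j = x_j for 1 ≤ j ≤ length xs, and 0 beyond.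
at : List ℕ → ℕ → ℕ
at xs zero = 0
at [] (suc j) = 0
at (x ∷ xs) (suc zero) = x
at (x ∷ xs) (suc (suc j)) = at xs (suc j)

gcdList : List ℕ → ℕ
gcdList = foldr gcd 0

-- (d , r) is an arithmetical structure on the path graph P_N
-- (vertices 1..N, edges {j,j+1}):  d, r positive integer vectors of length N,
-- r primitive, and (diag(d) - A) r = 0, i.e. d_j r_j = r_{j-1} + r_{j+1}
-- for every vertex j (with r_0 = r_{N+1} = 0, i.e. missing neighbours).
IsArithStruct : (N : ℕ) → List ℕ → List ℕ → Set
IsArithStruct N d r =
  length d ≡ N × length r ≡ N ×
  All (0 <_) d × All (0 <_) r ×
  gcdList r ≡ 1 ×
  (∀ j → 1 ≤ j → j ≤ N → at d j * at r j ≡ at r (j ∸ 1) + at r (suc j))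

laplacianD : ℕ → List ℕ
laplacianD m = 1 ∷ replicate (m ∸ 2) 2 ++ [ 1 ]

laplacianR : ℕ → List ℕ
laplacianR m = replicate m 1

-- Subdivision at position p = k + 1 (so 1 ≤ k ≤ N - 1): a new vertex is inserted
-- between vertices k and k+1.
--   d: d_k ↦ d_k + 1, new entry 1, d_{k+1} ↦ d_{k+1} + 1
--   r: new entry r_k + r_{k+1}
-- (Outside the valid range the input is returned unchanged; never used there.)
subdivD : ℕ → List ℕ → List ℕ
subdivD (suc zero) (x ∷ y ∷ xs) = suc x ∷ 1 ∷ suc y ∷ xs
subdivD (suc (suc k)) (x ∷ xs) = x ∷ subdivD (suc k) xs
subdivD _ xs = xs

subdivR : ℕ → List ℕ → List ℕ
subdivR (suc zero) (x ∷ y ∷ xs) = x ∷ (x + y) ∷ y ∷ xs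
subdivR (suc (suc k)) (x ∷ xs) = x ∷ subdivR (suc k) xs
subdivR _ xs = xs

subdiv : ℕ → List ℕ × List ℕ → List ℕ × List ℕ
subdiv k (d , r) = subdivD k d , subdivR k r

-- A_n(b): m = n - length b; start from the Laplacian structure on P_m and, for
-- i = 1, ..., n - m, subdivide at position b_i + 1 (i.e. between b_i and b_i + 1).
A : (n : ℕ) → List ℕ → List ℕ × List ℕ
A n b = foldl (λ s bi → subdiv bi s) (laplacianD m , laplacianR m) b
  where m = n ∸ length b

-- Admissible sequence b for P_n: with m = n - length b, 2 ≤ m,
-- 1 ≤ b_i ≤ i + m - 2 for all i (1-indexed; for the 0-indexed i' = i - 1 the
-- bound is i' + m - 1), and b weakly increasing.
Admissible : ℕ → List ℕ → Set
Admissible n b =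
  2 ≤ n ∸ length b ×
  (∀ (i : Fin (length b)) → 1 ≤ lookup b i × lookup b i ≤ toℕ i + (n ∸ length b) ∸ 1) ×
  Linked _≤_ b

-- If some vertex j with 1 < j < n has d_j = 1, then r_j = r_(j-1) + r_(j+1), and deleting
-- vertex j (smoothing) leaves an arithmetical structure on P_(n-1) whose subdivision at
-- position j is the original one. If there is no such vertex, r_(j+1) = d_j r_j - r_(j-1) ≥ r_j
-- makes r weakly increasing, and d_n r_n = r_(n-1) then forces r to be constant: the structure
-- is Laplacian. Subdividing at position x + 1 creates a 1 there and only shifts the entries to
-- its right, so for weakly increasing b the rightmost interior 1 of A_n(b) sits at b_last + 1.
-- Smoothing the rightmost interior 1 therefore constructs b by induction on n, and the same
-- observation shows that the last entry of b, hence all of b, is forced.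
module Submission where

open import Defs
open import Data.Nat
  using (ℕ; zero; suc; _+_; _*_; _∸_; _≤_; _<_; _≥_; z≤n; s≤s; pred; >-nonZero)
open import Data.Nat.Properties
open import Algebra.Properties.CommutativeSemigroup +-commutativeSemigroup using (x∙yz≈y∙xz)
open import Data.Nat.Divisibility using (_∣_; ∣1⇒≡1; ∣m∣n⇒∣m+n; _∣0; ∣-refl)
open import Data.Nat.GCD using (gcd-greatest)
open import Data.List
  using (List; []; _∷_; _++_; [_]; replicate; length; foldr; foldl; lookup; reverse; _∷ʳ_; _ʳ++_)
open import Data.List.Properties
  using (length-++; length-replicate; length-reverse; reverse-involutive; reverse-foldl; unfold-reverse)
open import Data.List.Relation.Unary.All using (All; []; _∷_)
open import Data.List.Relation.Unary.All.Properties using (++⁺; replicate⁺)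
open import Data.List.Relation.Unary.Linked as Linked using (Linked; []; [-]; _∷_)
open import Data.Fin using (Fin; toℕ; zero; suc)
open import Data.Product using (∃-syntax; ∃!; _×_; _,_; proj₁; proj₂)
open import Data.Sum using (_⊎_; inj₁; inj₂)
open import Function using (flip)
open import Relation.Binary using (Rel)
open import Relation.Nullary using (¬_; yes; no; contradiction)
open import Relation.Nullary.Decidable using (_×-dec_)
open import Relation.Unary using (Decidable)
open import Relation.Binary.PropositionalEquality
  using (_≡_; refl; sym; trans; cong; cong₂; subst; subst₂; module ≡-Reasoning)

cancel-middle : ∀ a m p c → a + m ≡ p + (a + c) → m ≡ p + c
cancel-middle a m p c eq = +-cancelˡ-≡ a m (p + c) (trans eq (x∙yz≈y∙xz p a c))

positive-factor : ∀ {m n o} → m * n ≡ o → 0 < o → 0 < m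
positive-factor {zero} refl ()
positive-factor {suc m} _ _ = s≤s z≤n

unit-multiplier : ∀ {m n o} → 0 < m → 0 < n → m * n ≡ o → o ≤ n → m ≡ 1 × o ≡ n
unit-multiplier {m} {n} 0<m 0<n eq o≤n
  with ≤-antisym (*-cancelʳ-≤ m 1 n {{>-nonZero 0<n}} mn≤1n) 0<m
  where
  mn≤1n : m * n ≤ 1 * n
  mn≤1n = subst₂ _≤_ (sym eq) (sym (*-identityˡ n)) o≤n
... | refl = refl , trans (sym eq) (*-identityˡ n)

NoneBetween : (ℕ → Set) → ℕ → ℕ → Set
NoneBetween P t n = ∀ {j} → t < j → j < n → ¬ P j

none-mono : ∀ {P s t n} → s ≤ t → NoneBetween P s n → NoneBetween P t n
none-mono s≤t none t<j = none (≤-<-trans s≤t t<j)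

none-extend : ∀ {P t n} → NoneBetween P t n → ¬ (t < n × P n) → NoneBetween P t (suc n)
none-extend none ¬new t<j j<1+n with m<1+n⇒m<n∨m≡n j<1+n
... | inj₁ j<n = none t<j j<n
... | inj₂ refl = λ Pn → ¬new (t<j , Pn)

module _ {P : ℕ → Set} (P? : Decidable P) where

  last-between : ∀ t n → NoneBetween P t n ⊎ ∃[ j ] (t < j × j < n × P j × NoneBetween P j n)
  last-between t zero = inj₁ λ _ ()
  last-between t (suc n) with t <? n ×-dec P? n | last-between t n
  ... | yes (t<n , Pn) | _ =
    inj₂ (n , t<n , n<1+n n , Pn , λ n<j j<1+n → contradiction n<j (≤⇒≯ (m<1+n⇒m≤n j<1+n)))
  ... | no ¬new | inj₁ none = inj₁ (none-extend none ¬new)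
  ... | no ¬new | inj₂ (j , t<j , j<n , Pj , none) =
    inj₂ (j , t<j , m<n⇒m<1+n j<n , Pj ,
          none-extend none (λ (_ , Pn) → ¬new (<-trans t<j j<n , Pn)))

OneAt : List ℕ → ℕ → Set
OneAt d j = at d j ≡ 1

none-tail : ∀ {x d t n} → NoneBetween (OneAt (x ∷ d)) (suc t) (suc n) → NoneBetween (OneAt d) t n
none-tail none {suc j} t<j j<n = none (s≤s t<j) (s≤s j<n)

-- Balanced p d r: all entries positive and d_j r_j = r_(j-1) + r_(j+1), where the
-- value p stands for r_0 and r_(N+1) = 0.
data Balanced : ℕ → List ℕ → List ℕ → Set where
  []   : ∀ {p} → Balanced p [] []
  cons : ∀ {p x y d r} → 0 < x → 0 < y → x * y ≡ p + at r 1 → Balanced y d r →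
         Balanced p (x ∷ d) (y ∷ r)

Primitive : List ℕ → Set
Primitive r = ∀ c → All (c ∣_) r → c ≡ 1

record Arithmetical (n : ℕ) (d r : List ℕ) : Set where
  field
    size     : length d ≡ n
    balanced : Balanced 0 d r
    coprime  : Primitive r

open Arithmetical

balanced-from-at : ∀ p d r → length d ≡ length r → All (0 <_) d → All (0 <_) r →
  (∀ j → j < length d → at d (suc j) * at r (suc j) ≡ at (p ∷ r) (suc j) + at r (suc (suc j))) →
  Balanced p d r
balanced-from-at p [] [] _ _ _ _ = []
balanced-from-at p [] (_ ∷ _) () _ _ _
balanced-from-at p (_ ∷ _) [] () _ _ _
balanced-from-at p (x ∷ d) (y ∷ r) len (px ∷ pd) (py ∷ pr) eqs =
  cons px py (eqs 0 (s≤s z≤n))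
    (balanced-from-at y d r (suc-injective len) pd pr (λ j j< → eqs (suc j) (s≤s j<)))

∣-gcdList : ∀ {c} r → All (c ∣_) r → c ∣ gcdList r
∣-gcdList [] [] = _ ∣0
∣-gcdList (_ ∷ r) (c∣x ∷ c∣r) = gcd-greatest c∣x (∣-gcdList r c∣r)

arithmetical : ∀ {n d r} → IsArithStruct n d r → Arithmetical n d r
arithmetical {n} {d} {r} (len-d , len-r , pos-d , pos-r , gcd≡1 , eqs) = record
  { size     = len-d
  ; balanced = balanced-from-at 0 d r (trans len-d (sym len-r)) pos-d pos-r
                 (λ j j< → trans (eqs (suc j) (s≤s z≤n) (subst (suc j ≤_) len-d j<))
                                 (cong (_+ at r (suc (suc j))) (shift j)))
  ; coprime  = λ c c∣r → ∣1⇒≡1 (subst (c ∣_) gcd≡1 (∣-gcdList r c∣r))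
  }
  where
  shift : ∀ j → at r j ≡ at (0 ∷ r) (suc j)
  shift zero    = refl
  shift (suc j) = refl

-- Subdivision and smoothing

smoothD : ℕ → List ℕ → List ℕ
smoothD (suc zero) (x ∷ _ ∷ z ∷ d) = pred x ∷ pred z ∷ d
smoothD (suc (suc k)) (x ∷ d) = x ∷ smoothD (suc k) d
smoothD _ d = d

smoothR : ℕ → List ℕ → List ℕ
smoothR (suc zero) (a ∷ _ ∷ c ∷ r) = a ∷ c ∷ r
smoothR (suc (suc k)) (a ∷ r) = a ∷ smoothR (suc k) r
smoothR _ r = r

smooth : ℕ → List ℕ × List ℕ → List ℕ × List ℕ
smooth k (d , r) = smoothD k d , smoothR k r

smoothD-subdivD : ∀ k d → smoothD k (subdivD k d) ≡ d
smoothD-subdivD zero d = refl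
smoothD-subdivD (suc zero) [] = refl
smoothD-subdivD (suc zero) (x ∷ []) = refl
smoothD-subdivD (suc zero) (x ∷ y ∷ d) = refl
smoothD-subdivD (suc (suc k)) [] = refl
smoothD-subdivD (suc (suc k)) (x ∷ d) = cong (x ∷_) (smoothD-subdivD (suc k) d)

smoothR-subdivR : ∀ k r → smoothR k (subdivR k r) ≡ r
smoothR-subdivR zero r = refl
smoothR-subdivR (suc zero) [] = refl
smoothR-subdivR (suc zero) (x ∷ []) = refl
smoothR-subdivR (suc zero) (x ∷ y ∷ r) = refl
smoothR-subdivR (suc (suc k)) [] = refl
smoothR-subdivR (suc (suc k)) (x ∷ r) = cong (x ∷_) (smoothR-subdivR (suc k) r)

subdiv-injective : ∀ k {s t} → subdiv k s ≡ subdiv k t → s ≡ t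
subdiv-injective k {s@(d , r)} {t@(d′ , r′)} eq = begin
  s                     ≡⟨ sym (cong₂ _,_ (smoothD-subdivD k d) (smoothR-subdivR k r)) ⟩
  smooth k (subdiv k s) ≡⟨ cong (smooth k) eq ⟩
  smooth k (subdiv k t) ≡⟨ cong₂ _,_ (smoothD-subdivD k d′) (smoothR-subdivR k r′) ⟩
  t                     ∎
  where open ≡-Reasoning

length-subdivD : ∀ k d → suc k < length d → length (subdivD (suc k) d) ≡ suc (length d)
length-subdivD zero (x ∷ y ∷ d) _ = refl
length-subdivD (suc k) (x ∷ d) (s≤s lt) = cong suc (length-subdivD k d lt)
length-subdivD zero [] ()
length-subdivD zero (x ∷ []) (s≤s ())
length-subdivD (suc k) [] ()

length-smoothD : ∀ k d → suc (suc k) < length d → suc (length (smoothD (suc k) d)) ≡ length d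
length-smoothD zero (x ∷ y ∷ z ∷ d) _ = refl
length-smoothD (suc k) (x ∷ d) (s≤s lt) = cong suc (length-smoothD k d lt)
length-smoothD zero [] ()
length-smoothD zero (x ∷ []) (s≤s ())
length-smoothD zero (x ∷ y ∷ []) (s≤s (s≤s ()))
length-smoothD (suc k) [] ()

subdivD-pos : ∀ k {d} → All (0 <_) d → All (0 <_) (subdivD k d)
subdivD-pos zero pd = pd
subdivD-pos (suc zero) [] = []
subdivD-pos (suc zero) (px ∷ []) = px ∷ []
subdivD-pos (suc zero) (_ ∷ _ ∷ pd) = s≤s z≤n ∷ s≤s z≤n ∷ s≤s z≤n ∷ pd
subdivD-pos (suc (suc k)) [] = []
subdivD-pos (suc (suc k)) (px ∷ pd) = px ∷ subdivD-pos (suc k) pd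

subdivR-∣ : ∀ k {c r} → All (c ∣_) r → All (c ∣_) (subdivR k r)
subdivR-∣ zero c∣r = c∣r
subdivR-∣ (suc zero) [] = []
subdivR-∣ (suc zero) (c∣x ∷ []) = c∣x ∷ []
subdivR-∣ (suc zero) (c∣x ∷ c∣y ∷ c∣r) = c∣x ∷ ∣m∣n⇒∣m+n c∣x c∣y ∷ c∣y ∷ c∣r
subdivR-∣ (suc (suc k)) [] = []
subdivR-∣ (suc (suc k)) (c∣x ∷ c∣r) = c∣x ∷ subdivR-∣ (suc k) c∣r

at-subdivD-new : ∀ k d → suc k < length d → at (subdivD (suc k) d) (suc (suc k)) ≡ 1
at-subdivD-new zero (x ∷ y ∷ d) _ = refl
at-subdivD-new (suc k) (x ∷ d) (s≤s lt) = at-subdivD-new k d lt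
at-subdivD-new zero [] ()
at-subdivD-new zero (x ∷ []) (s≤s ())
at-subdivD-new (suc k) [] ()

at-subdivD-next : ∀ k d → suc k < length d →
  at (subdivD (suc k) d) (suc (suc (suc k))) ≡ suc (at d (suc (suc k)))
at-subdivD-next zero (x ∷ y ∷ d) _ = refl
at-subdivD-next (suc k) (x ∷ d) (s≤s lt) = at-subdivD-next k d lt
at-subdivD-next zero [] ()
at-subdivD-next zero (x ∷ []) (s≤s ())
at-subdivD-next (suc k) [] ()

at-subdivD-shift : ∀ k d {j} → suc k < length d → suc (suc k) < j →
  at (subdivD (suc k) d) (suc j) ≡ at d j
at-subdivD-shift zero (x ∷ y ∷ d) {suc (suc (suc j))} _ _ = refl
at-subdivD-shift (suc k) (x ∷ d) {suc (suc j)} (s≤s lt) (s≤s k<j) = at-subdivD-shift k d lt k<j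
at-subdivD-shift zero [] ()
at-subdivD-shift zero (x ∷ []) (s≤s ())
at-subdivD-shift zero (x ∷ y ∷ d) {zero} _ ()
at-subdivD-shift zero (x ∷ y ∷ d) {suc zero} _ (s≤s ())
at-subdivD-shift zero (x ∷ y ∷ d) {suc (suc zero)} _ (s≤s (s≤s ()))
at-subdivD-shift (suc k) [] ()
at-subdivD-shift (suc k) (x ∷ d) {zero} _ ()
at-subdivD-shift (suc k) (x ∷ d) {suc zero} _ (s≤s ())

at-smoothR-head : ∀ k r → at (smoothR (suc k) r) 1 ≡ at r 1
at-smoothR-head zero [] = refl
at-smoothR-head zero (a ∷ []) = refl
at-smoothR-head zero (a ∷ b ∷ []) = refl
at-smoothR-head zero (a ∷ b ∷ c ∷ r) = refl
at-smoothR-head (suc k) [] = refl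
at-smoothR-head (suc k) (a ∷ r) = refl

at-pos : ∀ {d j} → All (0 <_) d → j < length d → 0 < at d (suc j)
at-pos {j = zero} (px ∷ _) _ = px
at-pos {j = suc j} (_ ∷ pd) (s≤s j<) = at-pos pd j<

subdivD-no-ones : ∀ k {n} d → length d ≡ n → suc k < n → All (0 <_) d →
  NoneBetween (OneAt d) (suc (suc k)) n →
  NoneBetween (OneAt (subdivD (suc k) d)) (suc (suc k)) (suc n)
subdivD-no-ones k d refl k<n pd none {suc j} (s≤s k+2≤j) (s≤s j<n) with m≤n⇒m<n∨m≡n k+2≤j
... | inj₂ refl = λ one →
  <-irrefl refl (subst (0 <_) (suc-injective (trans (sym (at-subdivD-next k d k<n)) one)) (at-pos pd k<n))
... | inj₁ k+2<j = λ one → none k+2<j j<n (trans (sym (at-subdivD-shift k d k<n k+2<j)) one)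

balanced-smooth : ∀ k {p d r} → Balanced p d r → suc (suc k) < length d → OneAt d (suc (suc k)) →
  Balanced p (smoothD (suc k) d) (smoothR (suc k) r) × subdiv (suc k) (smooth (suc k) (d , r)) ≡ (d , r)
balanced-smooth zero {p}
  (cons {x = suc x} {a} _ pa ex (cons {y = b} _ _ eb (cons {x = suc z} {c} {r = r} _ pc ez B))) _ refl =
  cons (positive-factor x*a≡ (≤-trans pc (m≤n+m c p))) pa x*a≡
    (cons (positive-factor z*c≡ (≤-trans pa (m≤m+n a (at r 1)))) pc z*c≡ B) ,
  cong (λ b → suc x ∷ 1 ∷ suc z ∷ _ , a ∷ b ∷ c ∷ r) (sym b≡)
  where
  b≡ : b ≡ a + c
  b≡ = trans (sym (*-identityˡ b)) eb
  x*a≡ : x * a ≡ p + c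
  x*a≡ = cancel-middle a (x * a) p c (trans ex (cong (p +_) b≡))
  z*c≡ : z * c ≡ a + at r 1
  z*c≡ = cancel-middle c (z * c) a (at r 1) (trans ez (trans (cong (_+ at r 1) b≡) (+-assoc a c (at r 1))))
balanced-smooth (suc k) (cons {x = x} {y} {r = r} px py e B) (s≤s lt) one
  with balanced-smooth k B lt one
... | B′ , subdiv≡ =
  cons px py (trans e (cong (_ +_) (sym (at-smoothR-head k r)))) B′ ,
  cong (λ (d , r) → x ∷ d , y ∷ r) subdiv≡
balanced-smooth zero [] ()
balanced-smooth zero (cons _ _ _ []) (s≤s ())
balanced-smooth zero (cons _ _ _ (cons _ _ _ [])) (s≤s (s≤s ()))
balanced-smooth zero (cons {x = zero} () _ _ _) _ _
balanced-smooth zero (cons _ _ _ (cons _ _ _ (cons {x = zero} () _ _ _))) _ _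
balanced-smooth (suc k) [] ()

arithmetical-smooth : ∀ {n k d r} → Arithmetical (suc n) d r → suc k < n → OneAt d (suc (suc k)) →
  Arithmetical n (smoothD (suc k) d) (smoothR (suc k) r) × subdiv (suc k) (smooth (suc k) (d , r)) ≡ (d , r)
arithmetical-smooth {n} {k} {d} {r} S k<n one = S′ , proj₂ smoothed
  where
  interior : suc (suc k) < length d
  interior = subst (suc (suc k) <_) (sym (size S)) (s≤s k<n)
  smoothed : Balanced 0 (smoothD (suc k) d) (smoothR (suc k) r) ×
             subdiv (suc k) (smooth (suc k) (d , r)) ≡ (d , r)
  smoothed = balanced-smooth k (balanced S) interior one
  S′ : Arithmetical n (smoothD (suc k) d) (smoothR (suc k) r)
  S′ = record
    { size     = suc-injective (trans (length-smoothD k d interior) (size S))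
    ; balanced = proj₁ smoothed
    ; coprime  = λ c c∣r →
        coprime S c (subst (All (c ∣_)) (cong proj₂ (proj₂ smoothed)) (subdivR-∣ (suc k) c∣r))
    }

-- Structures without interior ones are Laplacian

balanced-without-ones : ∀ {p x d y r} → Balanced p (x ∷ d) (y ∷ r) → p ≤ y →
  NoneBetween (OneAt (x ∷ d)) 0 (suc (length d)) →
  p ≡ y × x ∷ d ≡ replicate (length d) 2 ++ [ 1 ] × y ∷ r ≡ replicate (suc (length d)) y
balanced-without-ones (cons px py e []) p≤y _
  with unit-multiplier px py (trans e (+-identityʳ _)) p≤y
... | refl , p≡y = p≡y , refl , refl
balanced-without-ones {p} {suc (suc x)} {_ ∷ _} {y} (cons {r = y′ ∷ _} _ py e B) p≤y none
  with balanced-without-ones B y≤y′ (none-tail (none-mono z≤n none))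
  where
  open ≤-Reasoning
  y≤y′ : y ≤ y′
  y≤y′ = +-cancelˡ-≤ y y y′ (begin
    y + y              ≤⟨ +-monoʳ-≤ y (m≤m+n y (x * y)) ⟩
    suc (suc x) * y    ≡⟨ e ⟩
    p + y′             ≤⟨ +-monoˡ-≤ y′ p≤y ⟩
    y + y′             ∎)
... | refl , d≡ , r≡
  with unit-multiplier {suc x} (s≤s z≤n) py (+-cancelˡ-≡ y (suc x * y) p (trans e (+-comm p y))) p≤y
... | refl , p≡y = p≡y , cong (2 ∷_) d≡ , cong (y ∷_) r≡
balanced-without-ones {x = zero} (cons () _ _ _) _ _
balanced-without-ones {x = suc zero} (cons _ _ _ (cons _ _ _ _)) _ none =
  contradiction refl (none (s≤s z≤n) (s≤s (s≤s z≤n)))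

laplacian-unique : ∀ {n d r} → Arithmetical n d r → 2 ≤ n → NoneBetween (OneAt d) 1 n →
  (d , r) ≡ (laplacianD n , laplacianR n)
laplacian-unique {d = x ∷ x′ ∷ d} {y ∷ y′ ∷ r}
  record { size = refl ; balanced = cons px py e B ; coprime = coprime-r } _ none
  with balanced-without-ones B (subst (y ≤_) e (m≤n*m y x {{>-nonZero px}})) (none-tail none)
... | refl , d≡ , r≡ with unit-multiplier px py e ≤-refl
... | refl , _ =
  cong₂ _,_ (cong (1 ∷_) d≡) (trans (cong (y ∷_) r≡) (cong (replicate (suc (suc (length d)))) y≡1))
  where
  y≡1 : y ≡ 1
  y≡1 = coprime-r y (subst (All (y ∣_)) (cong (y ∷_) (sym r≡)) (replicate⁺ _ ∣-refl))
laplacian-unique {d = []} record { size = refl } () _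
laplacian-unique {d = _ ∷ []} record { size = refl } (s≤s ()) _
laplacian-unique {d = _ ∷ _ ∷ _} {[]} record { balanced = () } _ _
laplacian-unique {d = _ ∷ _ ∷ _} {_ ∷ []} record { balanced = cons _ _ _ () } _ _

-- Subdivision sequences, most recent position first

latest : List ℕ → ℕ
latest [] = 0
latest (x ∷ _) = x

-- build n (reverse b) is A n b, but with the last subdivision outermost:
-- build (suc n) (x ∷ c) reduces to subdiv x (build n c).
build : ℕ → List ℕ → List ℕ × List ℕ
build n c = foldr subdiv (laplacianD (n ∸ length c) , laplacianR (n ∸ length c)) c

A-reverse : ∀ n c → A n (reverse c) ≡ build n c
A-reverse n c = begin
  A n (reverse c)
    ≡⟨ cong (λ l → foldl step (laplacian (n ∸ l)) (reverse c)) (length-reverse c) ⟩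
  foldl step (laplacian (n ∸ length c)) (reverse c)
    ≡⟨ reverse-foldl step _ c ⟩
  build n c
    ∎
  where
  open ≡-Reasoning
  step : List ℕ × List ℕ → ℕ → List ℕ × List ℕ
  step s x = subdiv x s
  laplacian : ℕ → List ℕ × List ℕ
  laplacian m = laplacianD m , laplacianR m

data Admissibleʳ : ℕ → List ℕ → Set where
  base : ∀ {n} → 2 ≤ n → Admissibleʳ n []
  step : ∀ {n k c} → suc k < n → latest c ≤ suc k → Admissibleʳ n c →
         Admissibleʳ (suc n) (suc k ∷ c)

LookupBounds : ℕ → List ℕ → Set
LookupBounds m b = ∀ (i : Fin (length b)) → 1 ≤ lookup b i × lookup b i ≤ toℕ i + m ∸ 1

data Bounded : ℕ → List ℕ → Set where
  []  : ∀ {m} → Bounded m []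
  _∷_ : ∀ {m x b} → 1 ≤ x × x < m → Bounded (suc m) b → Bounded m (x ∷ b)

≤∸1⇒< : ∀ {x m} → 1 ≤ x → x ≤ m ∸ 1 → x < m
≤∸1⇒< {m = zero} (s≤s z≤n) ()
≤∸1⇒< {m = suc m} _ x≤m = s≤s x≤m

<⇒≤∸1 : ∀ {x m} → x < m → x ≤ m ∸ 1
<⇒≤∸1 (s≤s x≤m) = x≤m

bounded⁻ : ∀ {m} b → LookupBounds m b → Bounded m b
bounded⁻ [] _ = []
bounded⁻ {m} (x ∷ b) bounds with bounds zero
... | 1≤x , x≤ = (1≤x , ≤∸1⇒< 1≤x x≤) ∷ bounded⁻ b tail
  where
  tail : LookupBounds (suc m) b
  tail i with bounds (suc i)
  ... | 1≤y , y≤ = 1≤y , subst (λ l → lookup b i ≤ l ∸ 1) (sym (+-suc (toℕ i) m)) y≤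

bounded⁺ : ∀ {m b} → Bounded m b → LookupBounds m b
bounded⁺ ((1≤x , x<m) ∷ _) zero = 1≤x , <⇒≤∸1 x<m
bounded⁺ {m} {_ ∷ b} (_ ∷ B) (suc i) with bounded⁺ B i
... | 1≤y , y≤ = 1≤y , subst (λ l → lookup b i ≤ l ∸ 1) (+-suc (toℕ i) m) y≤

bounded-∷ʳ⁻ : ∀ {m x} b → Bounded m (b ∷ʳ x) → Bounded m b × 1 ≤ x × x < length b + m
bounded-∷ʳ⁻ [] (h ∷ []) = [] , h
bounded-∷ʳ⁻ {m} {x} (_ ∷ b) (h ∷ B) with bounded-∷ʳ⁻ b B
... | B′ , 1≤x , x< = h ∷ B′ , 1≤x , subst (x <_) (+-suc (length b) m) x<

bounded-∷ʳ⁺ : ∀ {m x} b → Bounded m b → 1 ≤ x → x < length b + m → Bounded m (b ∷ʳ x)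
bounded-∷ʳ⁺ [] [] 1≤x x<m = (1≤x , x<m) ∷ []
bounded-∷ʳ⁺ {m} {x} (_ ∷ b) (h ∷ B) 1≤x x< =
  h ∷ bounded-∷ʳ⁺ b B 1≤x (subst (x <_) (sym (+-suc (length b) m)) x<)

module _ {a ℓ} {A : Set a} {R : Rel A ℓ} where

  linked-ʳ++ : ∀ {x xs ys} → Linked R (x ∷ xs) → Linked (flip R) (x ∷ ys) →
               Linked (flip R) ((x ∷ xs) ʳ++ ys)
  linked-ʳ++ [-] acc = acc
  linked-ʳ++ (Rxy ∷ L) acc = linked-ʳ++ L (Rxy ∷ acc)

  linked-reverse : ∀ {xs} → Linked R xs → Linked (flip R) (reverse xs)
  linked-reverse [] = []
  linked-reverse {_ ∷ _} L = linked-ʳ++ L [-]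

linked⇒latest≤ : ∀ {x c} → Linked _≥_ (x ∷ c) → latest c ≤ x
linked⇒latest≤ [-] = z≤n
linked⇒latest≤ (x≥y ∷ _) = x≥y

latest≤⇒linked : ∀ {x c} → latest c ≤ x → Linked _≥_ c → Linked _≥_ (x ∷ c)
latest≤⇒linked _ [] = [-]
latest≤⇒linked {c = _ ∷ _} x≥y L = x≥y ∷ L

length-reverse+∸ : ∀ n (c : List ℕ) → 2 ≤ n ∸ length c → length (reverse c) + (n ∸ length c) ≡ n
length-reverse+∸ n c 2≤m =
  trans (cong (_+ (n ∸ length c)) (length-reverse c))
        (m+[n∸m]≡n {length c} (<⇒≤ (m∸n≢0⇒n<m (m<n⇒n≢0 2≤m))))

admissibleʳ⁻ : ∀ n c → 2 ≤ n ∸ length c → Bounded (n ∸ length c) (reverse c) → Linked _≥_ c →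
  Admissibleʳ n c
admissibleʳ⁻ n [] 2≤n _ _ = base 2≤n
admissibleʳ⁻ zero (x ∷ c) () _ _
admissibleʳ⁻ (suc n) (x ∷ c) 2≤m B L
  with bounded-∷ʳ⁻ (reverse c) (subst (Bounded (n ∸ length c)) (unfold-reverse x c) B)
... | B′ , s≤s z≤n , x< = step x<n (linked⇒latest≤ L) (admissibleʳ⁻ n c 2≤m B′ (Linked.tail L))
  where
  x<n : x < n
  x<n = subst (x <_) (length-reverse+∸ n c 2≤m) x<

admissibleʳ⁺ : ∀ {n c} → Admissibleʳ n c →
  2 ≤ n ∸ length c × Bounded (n ∸ length c) (reverse c) × Linked _≥_ c
admissibleʳ⁺ (base 2≤n) = 2≤n , [] , []
admissibleʳ⁺ {suc n} {x ∷ c} (step x<n latest≤x a) with admissibleʳ⁺ a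
... | 2≤m , B , L =
  2≤m , subst (Bounded _) (sym (unfold-reverse x c)) (bounded-∷ʳ⁺ (reverse c) B (s≤s z≤n) x<) ,
  latest≤⇒linked latest≤x L
  where
  x< : x < length (reverse c) + (n ∸ length c)
  x< = subst (x <_) (sym (length-reverse+∸ n c 2≤m)) x<n

admissible⁻ : ∀ {n c} → Admissible n (reverse c) → Admissibleʳ n c
admissible⁻ {n} {c} (2≤m , bounds , L) =
  admissibleʳ⁻ n c (subst (λ l → 2 ≤ n ∸ l) len 2≤m)
    (subst (λ l → Bounded (n ∸ l) (reverse c)) len (bounded⁻ (reverse c) bounds))
    (subst (Linked _≥_) (reverse-involutive c) (linked-reverse L))
  where len = length-reverse c

admissible⁺ : ∀ {n c} → Admissibleʳ n c → Admissible n (reverse c)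
admissible⁺ {n} {c} a with admissibleʳ⁺ a
... | 2≤m , B , L =
  subst (λ l → 2 ≤ n ∸ l) (sym len) 2≤m ,
  bounded⁺ (subst (λ l → Bounded (n ∸ l) (reverse c)) (sym len) B) ,
  linked-reverse L
  where len = length-reverse c

-- The rightmost interior one of build n c sits at latest c + 1

length-laplacianD : ∀ {n} → 2 ≤ n → length (laplacianD n) ≡ n
length-laplacianD {suc (suc L)} _ =
  cong suc (trans (length-++ (replicate L 2)) (trans (cong (_+ 1) (length-replicate L)) (+-comm L 1)))
length-laplacianD {suc zero} (s≤s ())

laplacianD-pos : ∀ n → All (0 <_) (laplacianD n)
laplacianD-pos n = s≤s z≤n ∷ ++⁺ (replicate⁺ (n ∸ 2) (s≤s z≤n)) (s≤s z≤n ∷ [])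

at-replicate-++ : ∀ {L j} x ys → j < L → at (replicate L x ++ ys) (suc j) ≡ x
at-replicate-++ {suc L} {zero} x ys _ = refl
at-replicate-++ {suc L} {suc j} x ys (s≤s j<L) = at-replicate-++ x ys j<L

laplacianD-no-ones : ∀ n → NoneBetween (OneAt (laplacianD n)) 1 n
laplacianD-no-ones (suc (suc L)) {suc (suc j)} _ (s≤s (s≤s j<L)) one
  with trans (sym (at-replicate-++ 2 [ 1 ] j<L)) one
... | ()
laplacianD-no-ones (suc (suc L)) {suc zero} (s≤s ())
laplacianD-no-ones (suc zero) (s≤s (s≤s _)) (s≤s ())

shape : ∀ {n c} → Admissibleʳ n c →
  length (proj₁ (build n c)) ≡ n × All (0 <_) (proj₁ (build n c))
shape {n} (base 2≤n) = length-laplacianD 2≤n , laplacianD-pos n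
shape (step {k = k} k<n _ a) with shape a
... | len , pos =
  trans (length-subdivD k _ (subst (suc k <_) (sym len) k<n)) (cong suc len) , subdivD-pos (suc k) pos

no-ones-above : ∀ {n c} → Admissibleʳ n c → NoneBetween (OneAt (proj₁ (build n c))) (suc (latest c)) n
no-ones-above (base _) = laplacianD-no-ones _
no-ones-above (step {k = k} k<n latest≤ a) with shape a
... | len , pos =
  subdivD-no-ones k _ len k<n pos (none-mono (s≤s latest≤) (no-ones-above a))

one-at-latest : ∀ {n k c} → Admissibleʳ n (suc k ∷ c) →
  OneAt (proj₁ (build n (suc k ∷ c))) (suc (suc k))
one-at-latest (step k<n _ a) = at-subdivD-new _ _ (subst (_ <_) (sym (proj₁ (shape a))) k<n)

one-at⇒≤latest : ∀ {n c j} → Admissibleʳ n c → j < n → OneAt (proj₁ (build n c)) j →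
  j ≤ suc (latest c)
one-at⇒≤latest a j<n one = ≮⇒≥ λ latest<j → no-ones-above a latest<j j<n one

build-≡⇒head≤latest : ∀ {n k c₁ c₂} → Admissibleʳ n (suc k ∷ c₁) → Admissibleʳ n c₂ →
  build n (suc k ∷ c₁) ≡ build n c₂ → suc k ≤ latest c₂
build-≡⇒head≤latest {k = k} a₁@(step k<n _ _) a₂ eq =
  ≤-pred (one-at⇒≤latest a₂ (s≤s k<n)
    (subst (λ s → OneAt (proj₁ s) (suc (suc k))) eq (one-at-latest a₁)))

build-injective : ∀ {n c₁ c₂} → Admissibleʳ n c₁ → Admissibleʳ n c₂ →
  build n c₁ ≡ build n c₂ → c₁ ≡ c₂
build-injective (base _) (base _) _ = refl
build-injective a₁@(base _) a₂@(step _ _ _) eq =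
  contradiction (build-≡⇒head≤latest a₂ a₁ (sym eq)) λ ()
build-injective a₁@(step _ _ _) a₂@(base _) eq =
  contradiction (build-≡⇒head≤latest a₁ a₂ eq) λ ()
build-injective a₁@(step _ _ a₁′) a₂@(step _ _ a₂′) eq
  with ≤-antisym (build-≡⇒head≤latest a₁ a₂ eq) (build-≡⇒head≤latest a₂ a₁ (sym eq))
... | refl = cong (_ ∷_) (build-injective a₁′ a₂′ (subdiv-injective _ eq))

no-ones-above⇒latest≤ : ∀ {n k c} → Admissibleʳ n c → suc k < n →
  NoneBetween (OneAt (subdivD (suc k) (proj₁ (build n c)))) (suc (suc k)) (suc n) → latest c ≤ suc k
no-ones-above⇒latest≤ (base _) _ _ = z≤n
no-ones-above⇒latest≤ a@(step l<n _ _) k<n none = ≮⇒≥ λ k<l →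
  none (s≤s (s≤s (<⇒≤ k<l))) (s≤s (s≤s l<n))
    (trans (at-subdivD-shift _ _ (subst (_ <_) (sym (proj₁ (shape a))) k<n) (s≤s k<l)) (one-at-latest a))

existence : ∀ n {d r} → 2 ≤ n → Arithmetical n d r →
  ∃[ c ] (Admissibleʳ n c × build n c ≡ (d , r))
existence (suc n) {d} {r} 2≤n S with last-between (λ j → at d j ≟ 1) 1 (suc n)
... | inj₁ none = [] , base 2≤n , sym (laplacian-unique S 2≤n none)
... | inj₂ (suc (suc k) , _ , s≤s k<n , one , none) with arithmetical-smooth S k<n one
... | S′ , subdiv≡ with existence n (≤-trans (s≤s (s≤s z≤n)) k<n) S′
... | c , a , build≡ = suc k ∷ c , step k<n (no-ones-above⇒latest≤ a k<n none′) a , built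
  where
  built : build (suc n) (suc k ∷ c) ≡ (d , r)
  built = trans (cong (subdiv (suc k)) build≡) subdiv≡
  none′ : NoneBetween (OneAt (subdivD (suc k) (proj₁ (build n c)))) (suc (suc k)) (suc n)
  none′ = subst (λ s → NoneBetween (OneAt (proj₁ s)) (suc (suc k)) (suc n)) (sym built) none
existence (suc n) 2≤n S | inj₂ (zero , () , _)
existence (suc n) 2≤n S | inj₂ (suc zero , s≤s () , _)
existence zero () _


reverse-solution : ∀ {n b s} → Admissible n b × A n b ≡ s →
  Admissibleʳ n (reverse b) × build n (reverse b) ≡ s
reverse-solution {n} {b} {s} =
  subst (λ b′ → Admissible n b′ × A n b′ ≡ s →
               Admissibleʳ n (reverse b) × build n (reverse b) ≡ s)
        (reverse-involutive b)
        (λ (adm , A≡) → admissible⁻ adm , trans (sym (A-reverse n (reverse b))) A≡)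

proposition2p14 : (n : ℕ) → 2 ≤ n → (d r : List ℕ) → IsArithStruct n d r →
    ∃! _≡_ (λ (b : List ℕ) → Admissible n b × A n b ≡ (d , r))
proposition2p14 n 2≤n d r S with existence n 2≤n (arithmetical S)
... | c , a , build≡ = reverse c , (admissible⁺ a , trans (A-reverse n c) build≡) , unique
  where
  unique : ∀ {b} → Admissible n b × A n b ≡ (d , r) → reverse c ≡ b
  unique {b} solution with reverse-solution solution
  ... | a′ , build≡′ =
    trans (cong reverse (build-injective a a′ (trans build≡ (sym build≡′)))) (reverse-involutive b)
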